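{- Let $\pi$ be a permutation of $[n]$, $T\ge1$ and $m_1,\dots,m_T\ge1$. There exist pile assignments $\rho_t:[n]\to\{0,\dots,m_t-1\}$ ($t\in[T]$) such that the $T$-round stack shuffle of $\pi$ with $(\rho_1,\dots,\rho_T)$ yields the identity permutation if and only if either $T$ is even and $\mathrm{ascrun}(\pi)\le\prod_{t=1}^T m_t$, or $T$ is odd and $\mathrm{descrun}(\pi)\le\prod_{t=1}^T m_t$.
   Context: A deck of cards labelled by $[n]$ is represented by a permutation $\pi$ of $[n]$ with $\pi(s)$ the position (from the top) of label $s$. A single-round stack shuffle with pile assignments $\rho$ (label $s$ goes to pile $\rho(s)$, piles collected in increasing index order, each pile reversing placement order) maps $\pi$ to the unique permutation $\sigma$ of $[n]$ with $\sigma(s)<\sigma(t)$ iff $(\rho(s),-\pi(s))<(\rho(t),-\pi(t))$ lexicographically. A $T$-round stack shuffle with $(\rho_1,\dots,\rho_T)$ maps $\pi$ to $\pi_T$, where $\pi_0=\pi$ and $\pi_t$ is the single-round stack shuffle of $\pi_{t-1}$ with $\rho_t$; round $t$ has $m_t$ stacks. $\mathrm{ascrun}(\pi)$ and $\mathrm{descrun}(\pi)$ are the numbers of ascending runs and descending runs (maximal contiguous increasing, resp. decreasing, segments) of $(\pi(1),\dots,\pi(n))$. -}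

module Defs where

open import Data.Nat using (ℕ; zero; suc; _+_; _*_; _<_; _≤_)
open import Data.Nat.Properties using (_<?_)
open import Data.Fin using (Fin; toℕ; inject₁; fromℕ) renaming (zero to fzero; suc to fsuc)
open import Data.Fin.Permutation using (Permutation′; _⟨$⟩ʳ_)
open import Data.List using (List; []; _∷_; map; allFin)
open import Data.Product using (_×_; Σ)
open import Data.Sum using (_⊎_)
open import Function.Bundles using (_⇔_)
open import Relation.Binary.PropositionalEquality using (_≡_)
open import Relation.Nullary using (yes; no)

-- a permutation π of [n]; π ⟨$⟩ʳ s is the position (0-based) of label s
Perm : ℕ → Set
Perm n = Permutation′ n

pos : ∀ {n} → Perm n → Fin n → ℕ
pos π s = toℕ (π ⟨$⟩ʳ s)

prodF : (T : ℕ) → (Fin T → ℕ) → ℕ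
prodF zero    m = 1
prodF (suc T) m = m fzero * prodF T (λ i → m (fsuc i))

descFrom : ℕ → List ℕ → ℕ
descFrom x []       = 0
descFrom x (y ∷ ys) with y <? x
... | yes _ = suc (descFrom y ys)
... | no  _ = descFrom y ys

ascFrom : ℕ → List ℕ → ℕ
ascFrom x []       = 0
ascFrom x (y ∷ ys) with x <? y
... | yes _ = suc (ascFrom y ys)
... | no  _ = ascFrom y ys

-- number of maximal ascending runs (a nonempty sequence of distinct values
-- splits into 1 + #descents maximal increasing segments)
ascRunsList : List ℕ → ℕ
ascRunsList []       = 0
ascRunsList (x ∷ xs) = suc (descFrom x xs)

descRunsList : List ℕ → ℕ
descRunsList []       = 0
descRunsList (x ∷ xs) = suc (ascFrom x xs)

seqOf : ∀ {n} → Perm n → List ℕ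
seqOf {n} π = map (pos π) (allFin n)

ascrun : ∀ {n} → Perm n → ℕ
ascrun π = ascRunsList (seqOf π)

descrun : ∀ {n} → Perm n → ℕ
descrun π = descRunsList (seqOf π)

IsStackShuffle : ∀ {n m} → (Fin n → Fin m) → Perm n → Perm n → Set
IsStackShuffle {n} ρ π σ =
  ∀ (s t : Fin n) →
    (pos σ s < pos σ t) ⇔
    ((toℕ (ρ s) < toℕ (ρ t)) ⊎ ((toℕ (ρ s) ≡ toℕ (ρ t)) × (pos π t < pos π s)))

_≈ₚ_ : ∀ {n} → Perm n → Perm n → Set
_≈ₚ_ {n} π σ = ∀ (s : Fin n) → π ⟨$⟩ʳ s ≡ σ ⟨$⟩ʳ s

-- the T-round stack shuffle of π with (ρ_1,…,ρ_T) (rounds indexed by Fin T) is σ: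
-- there is a chain π_0 = π, π_{t+1} = shuffle of π_t by ρ_t, π_T = σ.
-- (Each single-round shuffle is unique, so this determines σ.)
IsMultiShuffle : ∀ {n} (T : ℕ) (m : Fin T → ℕ) →
  ((t : Fin T) → Fin n → Fin (m t)) → Perm n → Perm n → Set
IsMultiShuffle {n} T m ρ π σ =
  Σ (Fin (suc T) → Perm n) λ πs →
    (πs fzero ≈ₚ π) ×
    ((t : Fin T) → IsStackShuffle (ρ t) (πs (inject₁ t)) (πs (fsuc t))) ×
    (πs (fromℕ T) ≈ₚ σ)

{-# OPTIONS --safe #-}
-- Read π as the sequence of positions π(0), …, π(n−1); then ascrun π − 1 and descrun π − 1
-- are its numbers of descents and ascents. Let σ be a one-round shuffle of π into m piles.
-- Between consecutive labels the pile index cannot increase unless σ ascends there, and it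
-- strictly decreases where π descends and σ does not ascend. As the index lies in [0, m),
-- each descending run of σ contains at most m − 1 descents of π, so ascrun π ≤ m · descrun σ;
-- symmetrically descrun π ≤ m · ascrun σ. Both bounds are attained: put label s in pile
-- (number of descents of π after s) mod m; then σ can only ascend where this index wraps
-- around, which happens once every m descents of π (dually, count the ascents of π before s).
-- Ascents and descents trade places in every round and π is the identity iff ascrun π ≤ 1,
-- so induction on the number of rounds gives the theorem.
module Submission where

open import Defs
open import Data.Empty using (⊥-elim)
open import Data.Fin using (Fin; toℕ; fromℕ<; inject₁; fromℕ; punchOut; _≟_) renaming (zero to fzero; suc to fsuc)
open import Data.Fin.Permutation using (permutation; _⟨$⟩ʳ_; id)
open import Data.Fin.Properties
  using (toℕ-fromℕ<; toℕ-injective; toℕ-inject₁; toℕ<n; suc-injective; any?; punchOut-injective; injective⇒≤)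
open import Data.List using (tabulate)
open import Data.List.Properties using (map-tabulate)
open import Data.Nat using (ℕ; zero; suc; _+_; _*_; _≤_; _<_; z≤n; s≤s; NonZero; >-nonZero; >-nonZero⁻¹; parity)
open import Data.Nat.DivMod using (_%_; _/_; _mod_; m%n<n; m<n⇒m%n≡m; n%n≡0; m≡m%n+[m/n]*n; [m+kn]%n≡m%n)
open import Data.Nat.Properties
  using ( +-*-semiring; +-commutativeSemigroup; module ≤-Reasoning; <-isStrictTotalOrder; _<?_; <-cmp
        ; ≤-refl; ≤-reflexive; ≤-trans; ≤-antisym; ≤-pred; <-irrefl; <-asym; <⇒≢; 1+n≰n; 1+n≢0; n≤0⇒n≡0
        ; m≤n⇒m<n∨m≡n; m≤m+n; m≤n+m; +-comm; +-assoc; +-identityʳ; +-suc; +-mono-≤; +-monoˡ-≤; +-monoʳ-≤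
        ; +-mono-<-≤; +-mono-≤-<; *-identityʳ; *-zeroʳ; *-suc; *-monoʳ-≤; *-cancelˡ-< )
open import Algebra.Properties.Semiring.Sum +-*-semiring using (sum; *-distribˡ-sum)
open import Algebra.Properties.CommutativeSemigroup +-commutativeSemigroup
  using (xy∙z≈y∙xz; xy∙z≈x∙zy; x∙yz≈y∙xz)
open import Data.Parity.Base using (Parity; 0ℙ; 1ℙ; _⁻¹)
open import Data.Parity.Properties using (suc-homo-⁻¹)
open import Data.Product using (Σ; ∃; _×_; _,_; proj₁; proj₂)
open import Data.Product.Relation.Binary.Lex.Strict using (×-Lex; ×-isStrictTotalOrder)
open import Data.Product.Relation.Binary.Pointwise.NonDependent using (Pointwise)
open import Data.Sum using (_⊎_; inj₁; inj₂; [_,_])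
open import Data.Vec.Functional using (_∷_)
open import Function.Base using (_∘_; flip)
open import Function.Bundles using (_⇔_; mk⇔; Equivalence; Injection)
open import Function.Construct.Composition using (_⇔-∘_)
open import Function.Definitions using (Injective)
open import Function.Properties.Inverse using (↔⇒↣)
open import Level using (0ℓ)
open import Relation.Binary.Construct.Flip.EqAndOrd as Flip using ()
open import Relation.Binary.Core using (Rel)
open import Relation.Binary.Definitions using (tri<; tri≈; tri>)
open import Relation.Binary.PropositionalEquality
  using (_≡_; _≢_; refl; sym; trans; cong; subst; subst₂; module ≡-Reasoning)
open import Relation.Binary.Structures using (IsStrictTotalOrder)
open import Relation.Nullary using (Dec; yes; no; ¬_; contradiction)
open import Relation.Unary using (Pred; Decidable)

open Equivalence using (to; from)

-- Counting

indicator : ∀ {p} {P : Set p} → Dec P → ℕ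
indicator (yes _) = 1
indicator (no _)  = 0

indicator≤1 : ∀ {p} {P : Set p} (P? : Dec P) → indicator P? ≤ 1
indicator≤1 (yes _) = ≤-refl
indicator≤1 (no _)  = z≤n

sum-mono-≤ : ∀ {n} {f g : Fin n → ℕ} → (∀ i → f i ≤ g i) → sum f ≤ sum g
sum-mono-≤ {zero}  f≤g = z≤n
sum-mono-≤ {suc n} f≤g = +-mono-≤ (f≤g fzero) (sum-mono-≤ (f≤g ∘ fsuc))

sum-mono-< : ∀ {n} {f g : Fin n → ℕ} → (∀ i → f i ≤ g i) → ∀ j → f j < g j → sum f < sum g
sum-mono-< f≤g fzero    fj<gj = +-mono-<-≤ fj<gj (sum-mono-≤ (f≤g ∘ fsuc))
sum-mono-< f≤g (fsuc j) fj<gj = +-mono-≤-< (f≤g fzero) (sum-mono-< (f≤g ∘ fsuc) j fj<gj)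

count : ∀ {n p} {P : Pred (Fin n) p} → Decidable P → ℕ
count P? = sum (indicator ∘ P?)

count≤n : ∀ {n p} {P : Pred (Fin n) p} (P? : Decidable P) → count P? ≤ n
count≤n {zero}  P? = z≤n
count≤n {suc n} P? = +-mono-≤ (indicator≤1 (P? fzero)) (count≤n (P? ∘ fsuc))

count<n : ∀ {n p} {P : Pred (Fin n) p} (P? : Decidable P) {s} → ¬ P s → count P? < n
count<n {suc n} P? {fzero} ¬Ps with P? fzero
... | yes Ps = contradiction Ps ¬Ps
... | no _   = s≤s (count≤n (P? ∘ fsuc))
count<n {suc n} P? {fsuc s} ¬Ps = +-mono-≤-< (indicator≤1 (P? fzero)) (count<n (P? ∘ fsuc) ¬Ps)

count-mono-< : ∀ {n p q} {P : Pred (Fin n) p} {Q : Pred (Fin n) q} (P? : Decidable P) (Q? : Decidable Q) →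
               (∀ {u} → P u → Q u) → ∀ s → Q s → ¬ P s → count P? < count Q?
count-mono-< P? Q? P⊆Q s Qs ¬Ps = sum-mono-< indicator-mono s indicator-<
  where
  indicator-mono : ∀ u → indicator (P? u) ≤ indicator (Q? u)
  indicator-mono u with P? u | Q? u
  ... | yes Pu | no ¬Qu = contradiction (P⊆Q Pu) ¬Qu
  ... | yes _  | yes _  = ≤-refl
  ... | no _   | _      = z≤n
  indicator-< : indicator (P? s) < indicator (Q? s)
  indicator-< with P? s | Q? s
  ... | yes Ps | _      = contradiction Ps ¬Ps
  ... | no _   | no ¬Qs = contradiction Qs ¬Qs
  ... | no _   | yes _  = s≤s z≤n

count≡0⇒¬ : ∀ {n p} {P : Pred (Fin n) p} (P? : Decidable P) → count P? ≡ 0 → ∀ i → ¬ P i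
count≡0⇒¬ {suc n} P? eq i Pi with P? fzero | i
... | yes _  | _      = 1+n≢0 eq
... | no ¬P₀ | fzero  = ¬P₀ Pi
... | no _   | fsuc j = count≡0⇒¬ (P? ∘ fsuc) eq j Pi

¬⇒count≡0 : ∀ {n p} {P : Pred (Fin n) p} (P? : Decidable P) → (∀ i → ¬ P i) → count P? ≡ 0
¬⇒count≡0 {zero}  P? ¬P = refl
¬⇒count≡0 {suc n} P? ¬P with P? fzero
... | yes P₀ = contradiction P₀ (¬P fzero)
... | no _   = ¬⇒count≡0 (P? ∘ fsuc) (¬P ∘ fsuc)

countFrom : ∀ {n p} {P : Pred (Fin n) p} → Decidable P → Fin (suc n) → ℕ
countFrom P? fzero = count P?
countFrom {suc n} P? (fsuc i) = countFrom (P? ∘ fsuc) i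

countFrom-inject₁ : ∀ {n p} {P : Pred (Fin n) p} (P? : Decidable P) i →
                    countFrom P? (inject₁ i) ≡ indicator (P? i) + countFrom P? (fsuc i)
countFrom-inject₁ P? fzero    = refl
countFrom-inject₁ P? (fsuc i) = countFrom-inject₁ (P? ∘ fsuc) i

countFrom-last : ∀ {n p} {P : Pred (Fin n) p} (P? : Decidable P) → countFrom P? (fromℕ n) ≡ 0
countFrom-last {zero}  P? = refl
countFrom-last {suc n} P? = countFrom-last (P? ∘ fsuc)

countBefore : ∀ {n p} {P : Pred (Fin n) p} → Decidable P → Fin (suc n) → ℕ
countBefore P? fzero = 0
countBefore {suc n} P? (fsuc i) = indicator (P? fzero) + countBefore (P? ∘ fsuc) i

countBefore-suc : ∀ {n p} {P : Pred (Fin n) p} (P? : Decidable P) i →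
                  countBefore P? (fsuc i) ≡ indicator (P? i) + countBefore P? (inject₁ i)
countBefore-suc P? fzero    = refl
countBefore-suc P? (fsuc i) = trans (cong (indicator (P? fzero) +_) (countBefore-suc (P? ∘ fsuc) i))
                                    (x∙yz≈y∙xz (indicator (P? fzero)) (indicator (P? (fsuc i))) _)

-- Modular arithmetic and telescoping sums

[1+m]%n≡[1+m%n]%n : ∀ m n .{{_ : NonZero n}} → suc m % n ≡ suc (m % n) % n
[1+m]%n≡[1+m%n]%n m n = begin
  suc m % n                     ≡⟨ cong (λ k → suc k % n) (m≡m%n+[m/n]*n m n) ⟩
  (suc (m % n) + m / n * n) % n ≡⟨ [m+kn]%n≡m%n (suc (m % n)) (m / n) n ⟩
  suc (m % n) % n               ∎
  where open ≡-Reasoning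

[1+m]%n-cases : ∀ m n .{{_ : NonZero n}} → suc m % n ≡ suc (m % n) ⊎ (suc m % n ≡ 0 × suc (m % n) ≡ n)
[1+m]%n-cases m n with m≤n⇒m<n∨m≡n (m%n<n m n)
... | inj₁ 1+m%n<n = inj₁ (trans ([1+m]%n≡[1+m%n]%n m n) (m<n⇒m%n≡m 1+m%n<n))
... | inj₂ 1+m%n≡n = inj₂ (trans ([1+m]%n≡[1+m%n]%n m n) (trans (cong (_% n) 1+m%n≡n) (n%n≡0 n)) , 1+m%n≡n)

toℕ-mod : ∀ c m .{{_ : NonZero m}} → toℕ (c mod m) ≡ c % m
toℕ-mod c m = toℕ-fromℕ< (m%n<n c m)

0%m≡0 : ∀ m .{{_ : NonZero m}} → 0 % m ≡ 0
0%m≡0 m = m<n⇒m%n≡m (>-nonZero⁻¹ m)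

a+x≤y+m*b⇒1+a≤m*[1+b] : ∀ {a b x y} m → a + x ≤ y + m * b → y < m → suc a ≤ m * suc b
a+x≤y+m*b⇒1+a≤m*[1+b] {a} {b} {x} {y} m a+x≤y+mb y<m = begin
  suc a          ≤⟨ s≤s (m≤m+n a x) ⟩
  suc (a + x)    ≤⟨ s≤s a+x≤y+mb ⟩
  suc y + m * b  ≤⟨ +-monoˡ-≤ (m * b) y<m ⟩
  m + m * b      ≡⟨ *-suc m b ⟨
  m * suc b      ∎
  where open ≤-Reasoning

m*b≤a⇒1+a≤m*k⇒1+b≤k : ∀ {a b k} m → m * b ≤ a → suc a ≤ m * k → suc b ≤ k
m*b≤a⇒1+a≤m*k⇒1+b≤k {a} {b} {k} m m*b≤a 1+a≤m*k = *-cancelˡ-< m b k (≤-trans (s≤s m*b≤a) 1+a≤m*k)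

sum+last≤first+sum : ∀ {n} (f g : Fin n → ℕ) (r : Fin (suc n) → ℕ) →
                     (∀ i → f i + r (fsuc i) ≤ r (inject₁ i) + g i) →
                     sum f + r (fromℕ n) ≤ r fzero + sum g
sum+last≤first+sum {zero}  f g r step = ≤-reflexive (sym (+-identityʳ (r fzero)))
sum+last≤first+sum {suc n} f g r step = begin
  f fzero + sum (f ∘ fsuc) + r (fromℕ (suc n))    ≡⟨ +-assoc (f fzero) _ _ ⟩
  f fzero + (sum (f ∘ fsuc) + r (fromℕ (suc n)))  ≤⟨ +-monoʳ-≤ (f fzero) tail ⟩
  f fzero + (r (fsuc fzero) + sum (g ∘ fsuc))     ≡⟨ +-assoc (f fzero) _ _ ⟨
  f fzero + r (fsuc fzero) + sum (g ∘ fsuc)       ≤⟨ +-monoˡ-≤ _ (step fzero) ⟩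
  r fzero + g fzero + sum (g ∘ fsuc)              ≡⟨ +-assoc (r fzero) _ _ ⟩
  r fzero + sum g                                 ∎
  where
  open ≤-Reasoning
  tail = sum+last≤first+sum (f ∘ fsuc) (g ∘ fsuc) (r ∘ fsuc) (step ∘ fsuc)

sum+first≤last+sum : ∀ {n} (f g : Fin n → ℕ) (r : Fin (suc n) → ℕ) →
                     (∀ i → f i + r (inject₁ i) ≤ r (fsuc i) + g i) →
                     sum f + r fzero ≤ r (fromℕ n) + sum g
sum+first≤last+sum {zero}  f g r step = ≤-reflexive (sym (+-identityʳ (r fzero)))
sum+first≤last+sum {suc n} f g r step = begin
  f fzero + sum (f ∘ fsuc) + r fzero               ≡⟨ xy∙z≈y∙xz (f fzero) _ _ ⟩
  sum (f ∘ fsuc) + (f fzero + r fzero)             ≤⟨ +-monoʳ-≤ (sum (f ∘ fsuc)) (step fzero) ⟩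
  sum (f ∘ fsuc) + (r (fsuc fzero) + g fzero)      ≡⟨ +-assoc (sum (f ∘ fsuc)) _ _ ⟨
  sum (f ∘ fsuc) + r (fsuc fzero) + g fzero        ≤⟨ +-monoˡ-≤ (g fzero) tail ⟩
  r (fromℕ (suc n)) + sum (g ∘ fsuc) + g fzero     ≡⟨ xy∙z≈x∙zy (r (fromℕ (suc n))) _ _ ⟩
  r (fromℕ (suc n)) + sum g                        ∎
  where
  open ≤-Reasoning
  tail = sum+first≤last+sum (f ∘ fsuc) (g ∘ fsuc) (r ∘ fsuc) (step ∘ fsuc)

-- Sorting by an injective key

injective⇒onto : ∀ {n} {f : Fin n → Fin n} → Injective _≡_ _≡_ f → ∀ j → ∃ λ s → f s ≡ j
injective⇒onto {suc k} {f} f-injective j with any? (λ s → f s ≟ j)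
... | yes found = found
... | no ¬found = contradiction (injective⇒≤ g-injective) 1+n≰n
  where
  j≢f : ∀ s → j ≢ f s
  j≢f s j≡fs = ¬found (s , sym j≡fs)
  g : Fin (suc k) → Fin k
  g s = punchOut (j≢f s)
  g-injective : Injective _≡_ _≡_ g
  g-injective = f-injective ∘ punchOut-injective (j≢f _) (j≢f _)

pos-injective : ∀ {n} (π : Perm n) → Injective _≡_ _≡_ (pos π)
pos-injective π = Injection.injective (↔⇒↣ π) ∘ toℕ-injective

module _ {a ℓ₁ ℓ₂} {A : Set a} {_≈_ : Rel A ℓ₁} {_≺_ : Rel A ℓ₂} (sto : IsStrictTotalOrder _≈_ _≺_)
         {n} (key : Fin n → A) (key-injective : Injective _≡_ _≈_ key) where

  open IsStrictTotalOrder sto using (compare; irrefl; module Eq) renaming (_<?_ to _≺?_; trans to ≺-trans)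

  private
    rank : Fin n → ℕ
    rank s = count (λ u → key u ≺? key s)

    rank<n : ∀ s → rank s < n
    rank<n s = count<n _ (irrefl Eq.refl)

    rank-mono : ∀ {s t} → key s ≺ key t → rank s < rank t
    rank-mono {s} ks≺kt = count-mono-< _ _ (λ ku≺ks → ≺-trans ku≺ks ks≺kt) s ks≺kt (irrefl Eq.refl)

    rankFin : Fin n → Fin n
    rankFin s = fromℕ< (rank<n s)

    toℕ-rankFin : ∀ s → toℕ (rankFin s) ≡ rank s
    toℕ-rankFin s = toℕ-fromℕ< (rank<n s)

    rank-injective : ∀ {s t} → rank s ≡ rank t → s ≡ t
    rank-injective {s} {t} eq with compare (key s) (key t)
    ... | tri< ks≺kt _ _ = contradiction eq (<⇒≢ (rank-mono ks≺kt))
    ... | tri≈ _ ks≈kt _ = key-injective ks≈kt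
    ... | tri> _ _ kt≺ks = contradiction (sym eq) (<⇒≢ (rank-mono kt≺ks))

    rankFin-injective : Injective _≡_ _≡_ rankFin
    rankFin-injective {s} {t} eq = rank-injective (trans (sym (toℕ-rankFin s)) (trans (cong toℕ eq) (toℕ-rankFin t)))

    rankFin-onto : ∀ j → ∃ λ s → rankFin s ≡ j
    rankFin-onto = injective⇒onto rankFin-injective

  sortingPermutation : Perm n
  sortingPermutation = permutation rankFin (proj₁ ∘ rankFin-onto) (proj₂ ∘ rankFin-onto)
                                   (λ s → rankFin-injective (proj₂ (rankFin-onto (rankFin s))))

  sortingPermutation-<⇔ : ∀ s t → pos sortingPermutation s < pos sortingPermutation t ⇔ key s ≺ key t
  sortingPermutation-<⇔ s t = mk⇔ reflect (subst₂ _<_ (sym (toℕ-rankFin s)) (sym (toℕ-rankFin t)) ∘ rank-mono)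
    where
    reflect : toℕ (rankFin s) < toℕ (rankFin t) → key s ≺ key t
    reflect lt with compare (key s) (key t)
    ... | tri< ks≺kt _ _ = ks≺kt
    ... | tri≈ _ ks≈kt _ = ⊥-elim (<-irrefl (cong (toℕ ∘ rankFin) (key-injective ks≈kt)) lt)
    ... | tri> _ _ kt≺ks =
      contradiction (subst₂ _<_ (sym (toℕ-rankFin t)) (sym (toℕ-rankFin s)) (rank-mono kt≺ks)) (<-asym lt)

-- Stack shuffles

stackOrder-isStrictTotalOrder : IsStrictTotalOrder (Pointwise _≡_ _≡_) (×-Lex _≡_ _<_ (flip _<_))
stackOrder-isStrictTotalOrder = ×-isStrictTotalOrder <-isStrictTotalOrder (Flip.isStrictTotalOrder <-isStrictTotalOrder)

module StackOrder = IsStrictTotalOrder stackOrder-isStrictTotalOrder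

stackKey : ∀ {n m} → (Fin n → Fin m) → Perm n → Fin n → ℕ × ℕ
stackKey ρ π s = toℕ (ρ s) , pos π s

shuffle : ∀ {n m} → (Fin n → Fin m) → Perm n → Perm n
shuffle ρ π = sortingPermutation stackOrder-isStrictTotalOrder (stackKey ρ π) (pos-injective π ∘ proj₂)

shuffle-isStackShuffle : ∀ {n m} (ρ : Fin n → Fin m) (π : Perm n) → IsStackShuffle ρ π (shuffle ρ π)
shuffle-isStackShuffle ρ π =
  sortingPermutation-<⇔ stackOrder-isStrictTotalOrder (stackKey ρ π) (pos-injective π ∘ proj₂)

IsStackShuffle-resp : ∀ {n m} {ρ : Fin n → Fin m} {π π′ σ σ′ : Perm n} →
                      π ≈ₚ π′ → σ ≈ₚ σ′ → IsStackShuffle ρ π σ → IsStackShuffle ρ π′ σ′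
IsStackShuffle-resp {n} {ρ = ρ} {π} {π′} {σ} {σ′} π≈π′ σ≈σ′ sh s t = mk⇔
  (key-resp {stackKey ρ π} keys≈ ∘ to (sh s t) ∘ subst₂ _<_ (sym (σ≡ s)) (sym (σ≡ t)))
  (subst₂ _<_ (σ≡ s) (σ≡ t) ∘ from (sh s t) ∘ key-resp {stackKey ρ π′} (StackOrder.Eq.sym ∘ keys≈))
  where
  σ≡ : ∀ u → pos σ u ≡ pos σ′ u
  σ≡ u = cong toℕ (σ≈σ′ u)
  keys≈ : ∀ u → Pointwise _≡_ _≡_ (stackKey ρ π u) (stackKey ρ π′ u)
  keys≈ u = refl , cong toℕ (π≈π′ u)
  key-resp : ∀ {k k′ : Fin n → ℕ × ℕ} → (∀ u → Pointwise _≡_ _≡_ (k u) (k′ u)) →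
             ×-Lex _≡_ _<_ (flip _<_) (k s) (k t) → ×-Lex _≡_ _<_ (flip _<_) (k′ s) (k′ t)
  key-resp k≈k′ = StackOrder.<-respʳ-≈ (k≈k′ t) ∘ StackOrder.<-respˡ-≈ (k≈k′ s)

IsMultiShuffle-zero : ∀ {n} {m : Fin 0 → ℕ} {ρ : (t : Fin 0) → Fin n → Fin (m t)} {π σ : Perm n} →
                      IsMultiShuffle 0 m ρ π σ ⇔ π ≈ₚ σ
IsMultiShuffle-zero {π = π} = mk⇔
  (λ (_ , π₀≈π , _ , π₀≈σ) s → trans (sym (π₀≈π s)) (π₀≈σ s))
  (λ π≈σ → (λ _ → π) , (λ _ → refl) , (λ ()) , π≈σ)

IsMultiShuffle-suc : ∀ {n T} {m : Fin (suc T) → ℕ} {ρ : (t : Fin (suc T)) → Fin n → Fin (m t)}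
                     {π σ : Perm n} →
                     IsMultiShuffle (suc T) m ρ π σ ⇔
                     Σ (Perm n) λ π₁ →
                       IsStackShuffle (ρ fzero) π π₁ × IsMultiShuffle T (m ∘ fsuc) (ρ ∘ fsuc) π₁ σ
IsMultiShuffle-suc {ρ = ρ} {π} = mk⇔
  (λ (πs , π₀≈π , steps , πₜ≈σ) →
     πs (fsuc fzero) ,
     IsStackShuffle-resp {ρ = ρ fzero} {πs fzero} {π} {πs (fsuc fzero)} {πs (fsuc fzero)}
                         π₀≈π (λ _ → refl) (steps fzero) ,
     (πs ∘ fsuc , (λ _ → refl) , steps ∘ fsuc , πₜ≈σ))
  (λ (π₁ , sh , (πs , π₀≈π₁ , steps , πₜ≈σ)) →
     (π ∷ πs) , (λ _ → refl) ,
     (λ { fzero    → IsStackShuffle-resp {ρ = ρ fzero} {π} {π} {π₁} {πs fzero} (λ _ → refl) (λ s → sym (π₀≈π₁ s)) sh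
        ; (fsuc t) → steps t }) ,
     πₜ≈σ)

-- Ascents, descents and runs

Ascent Descent : ∀ {n} → (Fin (suc n) → ℕ) → Pred (Fin n) 0ℓ
Ascent  g i = g (inject₁ i) < g (fsuc i)
Descent g i = g (fsuc i) < g (inject₁ i)

ascent? : ∀ {n} (g : Fin (suc n) → ℕ) → Decidable (Ascent g)
ascent? g i = g (inject₁ i) <? g (fsuc i)

descent? : ∀ {n} (g : Fin (suc n) → ℕ) → Decidable (Descent g)
descent? g i = g (fsuc i) <? g (inject₁ i)

ascents descents : ∀ {n} → (Fin (suc n) → ℕ) → ℕ
ascents  g = count (ascent? g)
descents g = count (descent? g)

descFrom-tabulate : ∀ {n} (g : Fin (suc n) → ℕ) → descFrom (g fzero) (tabulate (g ∘ fsuc)) ≡ descents g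
descFrom-tabulate {zero}  g = refl
descFrom-tabulate {suc n} g with g (fsuc fzero) <? g fzero
... | yes _ = cong suc (descFrom-tabulate (g ∘ fsuc))
... | no _  = descFrom-tabulate (g ∘ fsuc)

ascFrom-tabulate : ∀ {n} (g : Fin (suc n) → ℕ) → ascFrom (g fzero) (tabulate (g ∘ fsuc)) ≡ ascents g
ascFrom-tabulate {zero}  g = refl
ascFrom-tabulate {suc n} g with g fzero <? g (fsuc fzero)
... | yes _ = cong suc (ascFrom-tabulate (g ∘ fsuc))
... | no _  = ascFrom-tabulate (g ∘ fsuc)

ascrun≡1+descents : ∀ {n} (π : Perm (suc n)) → ascrun π ≡ suc (descents (pos π))
ascrun≡1+descents π =
  trans (cong ascRunsList (map-tabulate (λ s → s) (pos π))) (cong suc (descFrom-tabulate (pos π)))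

descrun≡1+ascents : ∀ {n} (π : Perm (suc n)) → descrun π ≡ suc (ascents (pos π))
descrun≡1+ascents π =
  trans (cong descRunsList (map-tabulate (λ s → s) (pos π))) (cong suc (ascFrom-tabulate (pos π)))

increasing⇒≡a+toℕ : ∀ {n} (g : Fin (suc n) → ℕ) a → (∀ i → Ascent g i) →
                     a ≤ g fzero → g (fromℕ n) ≤ a + n → ∀ i → g i ≡ a + toℕ i
increasing⇒≡a+toℕ {zero} g a _ a≤g₀ g₀≤a+0 fzero =
  ≤-antisym g₀≤a+0 (subst (_≤ g fzero) (sym (+-identityʳ a)) a≤g₀)
increasing⇒≡a+toℕ {suc n} g a inc a≤g₀ gₙ≤a+n = λ where
    fzero    → ≤-antisym (≤-pred (≤-trans (inc fzero) (≤-reflexive (tail fzero))))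
                         (subst (_≤ g fzero) (sym (+-identityʳ a)) a≤g₀)
    (fsuc i) → trans (tail i) (sym (+-suc a (toℕ i)))
  where
  tail : ∀ i → g (fsuc i) ≡ suc a + toℕ i
  tail = increasing⇒≡a+toℕ (g ∘ fsuc) (suc a) (inc ∘ fsuc) (≤-trans (s≤s a≤g₀) (inc fzero))
                           (subst (g (fromℕ (suc n)) ≤_) (+-suc a n) gₙ≤a+n)

inject₁≢suc : ∀ {n} (i : Fin n) → inject₁ i ≢ fsuc i
inject₁≢suc fzero    ()
inject₁≢suc (fsuc i) eq = inject₁≢suc i (suc-injective eq)

ascrun≤1⇔≈id : ∀ {n} (π : Perm n) → ascrun π ≤ 1 ⇔ π ≈ₚ id
ascrun≤1⇔≈id {zero}  π = mk⇔ (λ _ ()) (λ _ → z≤n)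
ascrun≤1⇔≈id {suc n} π = mk⇔
  (λ ascrun≤1 s → toℕ-injective (increasing⇒≡a+toℕ (pos π) 0 (ascending ascrun≤1) z≤n (pos-last≤n) s))
  (λ π≈id → subst (_≤ 1) (sym (ascrun≡1+descents π))
                    (s≤s (≤-reflexive (¬⇒count≡0 (descent? (pos π)) (no-descent π≈id)))))
  where
  pos-last≤n : pos π (fromℕ n) ≤ n
  pos-last≤n = ≤-pred (toℕ<n (π ⟨$⟩ʳ fromℕ n))
  ascending : ascrun π ≤ 1 → ∀ i → Ascent (pos π) i
  ascending ascrun≤1 i with <-cmp (pos π (inject₁ i)) (pos π (fsuc i))
  ... | tri< asc _ _ = asc
  ... | tri≈ _ eq _  = contradiction (pos-injective π eq) (inject₁≢suc i)
  ... | tri> _ _ dsc = contradiction dsc (count≡0⇒¬ (descent? (pos π)) descents≡0 i)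
    where descents≡0 = n≤0⇒n≡0 (≤-pred (subst (_≤ 1) (ascrun≡1+descents π) ascrun≤1))
  no-descent : π ≈ₚ id → ∀ i → ¬ Descent (pos π) i
  no-descent π≈id i = <-asym (subst₂ _<_ (sym pos-inject₁) (sym pos-suc) ≤-refl)
    where
    pos-inject₁ : pos π (inject₁ i) ≡ toℕ i
    pos-inject₁ = trans (cong toℕ (π≈id (inject₁ i))) (toℕ-inject₁ i)
    pos-suc : pos π (fsuc i) ≡ suc (toℕ i)
    pos-suc = cong toℕ (π≈id (fsuc i))

runs : ∀ {n} → Parity → Perm n → ℕ
runs 0ℙ = ascrun
runs 1ℙ = descrun

-- A single round

module _ {n m} {ρ : Fin n → Fin m} {π σ : Perm n} (sh : IsStackShuffle ρ π σ) where

  shuffle-step-≤ : ∀ s t → indicator (pos π t <? pos π s) + toℕ (ρ t) ≤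
                           toℕ (ρ s) + m * indicator (pos σ s <? pos σ t)
  shuffle-step-≤ s t with pos σ s <? pos σ t
  ... | yes _ = begin
    indicator (pos π t <? pos π s) + toℕ (ρ t)  ≤⟨ +-monoˡ-≤ (toℕ (ρ t)) (indicator≤1 _) ⟩
    suc (toℕ (ρ t))                             ≤⟨ toℕ<n (ρ t) ⟩
    m                                           ≡⟨ *-identityʳ m ⟨
    m * 1                                       ≤⟨ m≤n+m (m * 1) (toℕ (ρ s)) ⟩
    toℕ (ρ s) + m * 1                           ∎
    where open ≤-Reasoning
  ... | no σs≮σt = ≤-trans descending (m≤m+n (toℕ (ρ s)) (m * 0))
    where
    descending : indicator (pos π t <? pos π s) + toℕ (ρ t) ≤ toℕ (ρ s)
    descending with <-cmp (toℕ (ρ s)) (toℕ (ρ t)) | pos π t <? pos π s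
    ... | tri< ρs<ρt _ _ | _         = contradiction (from (sh s t) (inj₁ ρs<ρt)) σs≮σt
    ... | tri≈ _ ρs≡ρt _ | yes πt<πs = contradiction (from (sh s t) (inj₂ (ρs≡ρt , πt<πs))) σs≮σt
    ... | tri≈ _ ρs≡ρt _ | no _      = ≤-reflexive (sym ρs≡ρt)
    ... | tri> _ _ ρt<ρs | _         = ≤-trans (+-monoˡ-≤ (toℕ (ρ t)) (indicator≤1 _)) ρt<ρs

  cyclic-step-≤ : .{{_ : NonZero m}} → ∀ {s t} c →
                  toℕ (ρ s) ≡ (indicator (pos π t <? pos π s) + c) % m → toℕ (ρ t) ≡ c % m →
                  m * indicator (pos σ s <? pos σ t) + toℕ (ρ s) ≤ toℕ (ρ t) + indicator (pos π t <? pos π s)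
  cyclic-step-≤ {s} {t} c ρs≡ ρt≡ with pos π t <? pos π s | pos σ s <? pos σ t
  ... | no πt≮πs | yes σs<σt = ⊥-elim ([ <-irrefl ρs≡ρt , πt≮πs ∘ proj₂ ] (to (sh s t) σs<σt))
    where ρs≡ρt = trans ρs≡ (sym ρt≡)
  ... | no _ | no _ = begin
    m * 0 + toℕ (ρ s)  ≡⟨ cong (_+ toℕ (ρ s)) (*-zeroʳ m) ⟩
    toℕ (ρ s)          ≡⟨ trans ρs≡ (sym ρt≡) ⟩
    toℕ (ρ t)          ≡⟨ +-identityʳ (toℕ (ρ t)) ⟨
    toℕ (ρ t) + 0      ∎
    where open ≤-Reasoning
  ... | yes _ | σ? with [1+m]%n-cases c m
  ...   | inj₂ (wrap₀ , wrapₘ) = begin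
    m * indicator σ? + toℕ (ρ s)  ≡⟨ cong (m * indicator σ? +_) (trans ρs≡ wrap₀) ⟩
    m * indicator σ? + 0          ≡⟨ +-identityʳ _ ⟩
    m * indicator σ?              ≤⟨ *-monoʳ-≤ m (indicator≤1 σ?) ⟩
    m * 1                         ≡⟨ *-identityʳ m ⟩
    m                             ≡⟨ trans (cong suc ρt≡) wrapₘ ⟨
    suc (toℕ (ρ t))               ≡⟨ +-comm 1 (toℕ (ρ t)) ⟩
    toℕ (ρ t) + 1                 ∎
    where open ≤-Reasoning
  ...   | inj₁ no-wrap with σ?
  ...     | yes σs<σt =
    ⊥-elim ([ <-asym ρt<ρs , (λ (ρs≡ρt , _) → <-irrefl (sym ρs≡ρt) ρt<ρs) ] (to (sh s t) σs<σt))
    where ρt<ρs = ≤-reflexive (sym (trans ρs≡ (trans no-wrap (cong suc (sym ρt≡)))))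
  ...     | no _ = begin
    m * 0 + toℕ (ρ s)  ≡⟨ cong (_+ toℕ (ρ s)) (*-zeroʳ m) ⟩
    toℕ (ρ s)          ≡⟨ trans ρs≡ (trans no-wrap (cong suc (sym ρt≡))) ⟩
    suc (toℕ (ρ t))    ≡⟨ +-comm 1 (toℕ (ρ t)) ⟩
    toℕ (ρ t) + 1      ∎
    where open ≤-Reasoning

ascrun≤m*descrun : ∀ {n m} {ρ : Fin n → Fin m} {π σ : Perm n} →
                   IsStackShuffle ρ π σ → ascrun π ≤ m * descrun σ
ascrun≤m*descrun {zero}          sh = z≤n
ascrun≤m*descrun {suc n} {m} {ρ} {π} {σ} sh = begin
  ascrun π                   ≡⟨ ascrun≡1+descents π ⟩
  suc (descents (pos π))     ≤⟨ a+x≤y+m*b⇒1+a≤m*[1+b] m telescoped (toℕ<n (ρ fzero)) ⟩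
  m * suc (ascents (pos σ))  ≡⟨ cong (m *_) (descrun≡1+ascents σ) ⟨
  m * descrun σ              ∎
  where
  open ≤-Reasoning
  telescoped : descents (pos π) + toℕ (ρ (fromℕ n)) ≤ toℕ (ρ fzero) + m * ascents (pos σ)
  telescoped = begin
    descents (pos π) + toℕ (ρ (fromℕ n))
      ≤⟨ sum+last≤first+sum (indicator ∘ descent? (pos π)) ((m *_) ∘ indicator ∘ ascent? (pos σ)) (toℕ ∘ ρ)
                            (λ i → shuffle-step-≤ {ρ = ρ} {π} {σ} sh (inject₁ i) (fsuc i)) ⟩
    toℕ (ρ fzero) + sum ((m *_) ∘ indicator ∘ ascent? (pos σ))
      ≡⟨ cong (toℕ (ρ fzero) +_) (*-distribˡ-sum m (indicator ∘ ascent? (pos σ))) ⟨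
    toℕ (ρ fzero) + m * ascents (pos σ)
      ∎

descrun≤m*ascrun : ∀ {n m} {ρ : Fin n → Fin m} {π σ : Perm n} →
                   IsStackShuffle ρ π σ → descrun π ≤ m * ascrun σ
descrun≤m*ascrun {zero}          sh = z≤n
descrun≤m*ascrun {suc n} {m} {ρ} {π} {σ} sh = begin
  descrun π                   ≡⟨ descrun≡1+ascents π ⟩
  suc (ascents (pos π))       ≤⟨ a+x≤y+m*b⇒1+a≤m*[1+b] m telescoped (toℕ<n (ρ (fromℕ n))) ⟩
  m * suc (descents (pos σ))  ≡⟨ cong (m *_) (ascrun≡1+descents σ) ⟨
  m * ascrun σ                ∎
  where
  open ≤-Reasoning
  telescoped : ascents (pos π) + toℕ (ρ fzero) ≤ toℕ (ρ (fromℕ n)) + m * descents (pos σ)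
  telescoped = begin
    ascents (pos π) + toℕ (ρ fzero)
      ≤⟨ sum+first≤last+sum (indicator ∘ ascent? (pos π)) ((m *_) ∘ indicator ∘ descent? (pos σ)) (toℕ ∘ ρ)
                            (λ i → shuffle-step-≤ {ρ = ρ} {π} {σ} sh (fsuc i) (inject₁ i)) ⟩
    toℕ (ρ (fromℕ n)) + sum ((m *_) ∘ indicator ∘ descent? (pos σ))
      ≡⟨ cong (toℕ (ρ (fromℕ n)) +_) (*-distribˡ-sum m (indicator ∘ descent? (pos σ))) ⟨
    toℕ (ρ (fromℕ n)) + m * descents (pos σ)
      ∎

pilesByLaterDescents : ∀ {n} m .{{_ : NonZero m}} → Perm (suc n) → Fin (suc n) → Fin m
pilesByLaterDescents m π s = countFrom (descent? (pos π)) s mod m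

pilesByEarlierAscents : ∀ {n} m .{{_ : NonZero m}} → Perm (suc n) → Fin (suc n) → Fin m
pilesByEarlierAscents m π s = countBefore (ascent? (pos π)) s mod m

m*ascents≤descents : ∀ {n} m .{{_ : NonZero m}} (π : Perm (suc n)) →
                     m * ascents (pos (shuffle (pilesByLaterDescents m π) π)) ≤ descents (pos π)
m*ascents≤descents {n} m π = begin
  m * ascents (pos σ)
    ≤⟨ m≤m+n _ (toℕ (ρ fzero)) ⟩
  m * ascents (pos σ) + toℕ (ρ fzero)
    ≡⟨ cong (_+ toℕ (ρ fzero)) (*-distribˡ-sum m (indicator ∘ ascent? (pos σ))) ⟩
  sum ((m *_) ∘ indicator ∘ ascent? (pos σ)) + toℕ (ρ fzero)
    ≤⟨ sum+first≤last+sum ((m *_) ∘ indicator ∘ ascent? (pos σ)) (indicator ∘ D?) (toℕ ∘ ρ) step ⟩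
  toℕ (ρ (fromℕ n)) + descents (pos π)
    ≡⟨ cong (_+ descents (pos π)) last-pile≡0 ⟩
  descents (pos π)
    ∎
  where
  open ≤-Reasoning
  ρ = pilesByLaterDescents m π
  σ = shuffle ρ π
  D? = descent? (pos π)
  last-pile≡0 : toℕ (ρ (fromℕ n)) ≡ 0
  last-pile≡0 = trans (toℕ-mod _ m) (trans (cong (_% m) (countFrom-last D?)) (0%m≡0 m))
  step : ∀ i → m * indicator (ascent? (pos σ) i) + toℕ (ρ (inject₁ i)) ≤ toℕ (ρ (fsuc i)) + indicator (D? i)
  step i = cyclic-step-≤ {ρ = ρ} {π} {σ} (shuffle-isStackShuffle ρ π) (countFrom D? (fsuc i))
             (trans (toℕ-mod _ m) (cong (_% m) (countFrom-inject₁ D? i))) (toℕ-mod _ m)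

m*descents≤ascents : ∀ {n} m .{{_ : NonZero m}} (π : Perm (suc n)) →
                     m * descents (pos (shuffle (pilesByEarlierAscents m π) π)) ≤ ascents (pos π)
m*descents≤ascents {n} m π = begin
  m * descents (pos σ)
    ≤⟨ m≤m+n _ (toℕ (ρ (fromℕ n))) ⟩
  m * descents (pos σ) + toℕ (ρ (fromℕ n))
    ≡⟨ cong (_+ toℕ (ρ (fromℕ n))) (*-distribˡ-sum m (indicator ∘ descent? (pos σ))) ⟩
  sum ((m *_) ∘ indicator ∘ descent? (pos σ)) + toℕ (ρ (fromℕ n))
    ≤⟨ sum+last≤first+sum ((m *_) ∘ indicator ∘ descent? (pos σ)) (indicator ∘ A?) (toℕ ∘ ρ) step ⟩
  toℕ (ρ fzero) + ascents (pos π)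
    ≡⟨ cong (_+ ascents (pos π)) (trans (toℕ-mod 0 m) (0%m≡0 m)) ⟩
  ascents (pos π)
    ∎
  where
  open ≤-Reasoning
  ρ = pilesByEarlierAscents m π
  σ = shuffle ρ π
  A? = ascent? (pos π)
  step : ∀ i → m * indicator (descent? (pos σ) i) + toℕ (ρ (fsuc i)) ≤ toℕ (ρ (inject₁ i)) + indicator (A? i)
  step i = cyclic-step-≤ {ρ = ρ} {π} {σ} (shuffle-isStackShuffle ρ π) (countBefore A? (inject₁ i))
             (trans (toℕ-mod _ m) (cong (_% m) (countBefore-suc A? i))) (toℕ-mod _ m)

runs≤m*runs-shuffle : ∀ {n m} p {ρ : Fin n → Fin m} {π σ : Perm n} →
                      IsStackShuffle ρ π σ → runs p π ≤ m * runs (p ⁻¹) σ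
runs≤m*runs-shuffle 0ℙ {ρ} {π} {σ} = ascrun≤m*descrun {ρ = ρ} {π} {σ}
runs≤m*runs-shuffle 1ℙ {ρ} {π} {σ} = descrun≤m*ascrun {ρ = ρ} {π} {σ}

runs≤m*k⇒shuffle-runs≤k : ∀ {n m k} p .{{_ : NonZero m}} (π : Perm n) → runs p π ≤ m * k →
                          Σ (Fin n → Fin m) λ ρ → runs (p ⁻¹) (shuffle ρ π) ≤ k
runs≤m*k⇒shuffle-runs≤k {zero} 0ℙ π _ = (λ ()) , z≤n
runs≤m*k⇒shuffle-runs≤k {zero} 1ℙ π _ = (λ ()) , z≤n
runs≤m*k⇒shuffle-runs≤k {suc n} {m} {k} 0ℙ π ascrun≤ = ρ , (begin
  descrun (shuffle ρ π)               ≡⟨ descrun≡1+ascents (shuffle ρ π) ⟩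
  suc (ascents (pos (shuffle ρ π)))   ≤⟨ m*b≤a⇒1+a≤m*k⇒1+b≤k m (m*ascents≤descents m π) 1+descents≤ ⟩
  k                                   ∎)
  where
  open ≤-Reasoning
  ρ = pilesByLaterDescents m π
  1+descents≤ : suc (descents (pos π)) ≤ m * k
  1+descents≤ = subst (_≤ m * k) (ascrun≡1+descents π) ascrun≤
runs≤m*k⇒shuffle-runs≤k {suc n} {m} {k} 1ℙ π descrun≤ = ρ , (begin
  ascrun (shuffle ρ π)                ≡⟨ ascrun≡1+descents (shuffle ρ π) ⟩
  suc (descents (pos (shuffle ρ π)))  ≤⟨ m*b≤a⇒1+a≤m*k⇒1+b≤k m (m*descents≤ascents m π) 1+ascents≤ ⟩
  k                                   ∎)
  where
  open ≤-Reasoning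
  ρ = pilesByEarlierAscents m π
  1+ascents≤ : suc (ascents (pos π)) ≤ m * k
  1+ascents≤ = subst (_≤ m * k) (descrun≡1+ascents π) descrun≤

-- Several rounds

SortableIn : ∀ {n} T (m : Fin T → ℕ) → Perm n → Set
SortableIn {n} T m π = Σ ((t : Fin T) → Fin n → Fin (m t)) λ ρ → IsMultiShuffle T m ρ π id

sortableIn⇔runs≤ : ∀ {n} T (m : Fin T → ℕ) → (∀ t → 1 ≤ m t) → (π : Perm n) →
                   SortableIn T m π ⇔ runs (parity T) π ≤ prodF T m
sortableIn⇔runs≤ zero m _ π = mk⇔
  (λ (ρ , ms) → from (ascrun≤1⇔≈id π) (to (IsMultiShuffle-zero {m = m} {ρ} {π} {id}) ms))
  (λ ascrun≤1 → (λ ()) , from (IsMultiShuffle-zero {m = m} {λ ()} {π} {id}) (to (ascrun≤1⇔≈id π) ascrun≤1))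
sortableIn⇔runs≤ {n} (suc T) m m≥1 π = mk⇔ forward backward
  where
  IH : ∀ π₁ → SortableIn T (m ∘ fsuc) π₁ ⇔ runs (parity T) π₁ ≤ prodF T (m ∘ fsuc)
  IH = sortableIn⇔runs≤ T (m ∘ fsuc) (m≥1 ∘ fsuc)
  forward : SortableIn (suc T) m π → runs (parity (suc T)) π ≤ prodF (suc T) m
  forward (ρ , ms) with to (IsMultiShuffle-suc {m = m} {ρ} {π} {id}) ms
  ... | π₁ , sh , ms′ = begin
    runs (parity (suc T)) π                  ≤⟨ runs≤m*runs-shuffle (parity (suc T)) {ρ fzero} {π} {π₁} sh ⟩
    m fzero * runs (parity (suc T) ⁻¹) π₁    ≡⟨ cong (λ p → m fzero * runs p π₁) (suc-homo-⁻¹ T) ⟩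
    m fzero * runs (parity T) π₁             ≤⟨ *-monoʳ-≤ (m fzero) (to (IH π₁) (ρ ∘ fsuc , ms′)) ⟩
    m fzero * prodF T (m ∘ fsuc)             ∎
    where open ≤-Reasoning
  backward : runs (parity (suc T)) π ≤ prodF (suc T) m → SortableIn (suc T) m π
  backward runs≤ =
    ρ , from (IsMultiShuffle-suc {m = m} {ρ} {π} {id}) (shuffle ρ₀ π , shuffle-isStackShuffle ρ₀ π , proj₂ sortable)
    where
    shuffled : Σ (Fin n → Fin (m fzero)) λ ρ₀ → runs (parity (suc T) ⁻¹) (shuffle ρ₀ π) ≤ prodF T (m ∘ fsuc)
    shuffled = runs≤m*k⇒shuffle-runs≤k (parity (suc T)) {{>-nonZero (m≥1 fzero)}} π runs≤
    ρ₀ = proj₁ shuffled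
    sortable : SortableIn T (m ∘ fsuc) (shuffle ρ₀ π)
    sortable = from (IH (shuffle ρ₀ π))
                    (subst (λ p → runs p (shuffle ρ₀ π) ≤ prodF T (m ∘ fsuc)) (suc-homo-⁻¹ T) (proj₂ shuffled))
    ρ : (t : Fin (suc T)) → Fin n → Fin (m t)
    ρ fzero    = ρ₀
    ρ (fsuc t) = proj₁ sortable t

runs-parity≤⇔ : ∀ {n} T (π : Perm n) M →
                runs (parity T) π ≤ M ⇔ (((T % 2 ≡ 0) × (ascrun π ≤ M)) ⊎ ((T % 2 ≡ 1) × (descrun π ≤ M)))
runs-parity≤⇔ zero          π M = mk⇔ (inj₁ ∘ (refl ,_)) [ proj₂ , (λ ()) ∘ proj₁ ]
runs-parity≤⇔ (suc zero)    π M = mk⇔ (inj₂ ∘ (refl ,_)) [ (λ ()) ∘ proj₁ , proj₂ ]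
runs-parity≤⇔ (suc (suc T)) π M = runs-parity≤⇔ T π M

lemma12 : (n : ℕ) (π : Perm n) (T : ℕ) → 1 ≤ T →
    (m : Fin T → ℕ) → ((t : Fin T) → 1 ≤ m t) →
    (Σ ((t : Fin T) → Fin n → Fin (m t)) λ ρ → IsMultiShuffle T m ρ π id)
      ⇔ (((T % 2 ≡ 0) × (ascrun π ≤ prodF T m)) ⊎ ((T % 2 ≡ 1) × (descrun π ≤ prodF T m)))
lemma12 n π T _ m m≥1 = runs-parity≤⇔ T π (prodF T m) ⇔-∘ sortableIn⇔runs≤ T m m≥1 π
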